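{- Let $p$ be a prime and $L\subseteq\mathbb{Z}/p\mathbb{Z}$ with $|L|=s$, and let $X$ be a finite set with $|X|\bmod p\notin L$. Then there exists no intersection-closed set system $\mathcal{F}$ of subsets of $X$ such that $|F|\bmod p\in L$ for all $F\in\mathcal{F}$ and every subset of $X$ of size at most $s$ is contained in some element of $\mathcal{F}$.
   Context: A set system is intersection-closed if it contains $I\cap I'$ whenever it contains $I,I'$. -}

module Defs where

open import Data.Nat using (ℕ; NonZero; _≤_)
open import Data.Nat.DivMod using (_mod_)
open import Data.Nat.Primality using (Prime)
open import Data.Fin.Subset using (Subset; _⊆_; _∩_; ∣_∣; _∈_; _∉_)
open import Data.Product using (Σ; _×_)
open import Relation.Nullary using (¬_)

-- A set system on the ground set X = Fin n, given as a predicate on subsets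
-- (every family of subsets of a finite set is finite).
SetSystem : ℕ → Set₁
SetSystem n = Subset n → Set

IntersectionClosed : ∀ {n} → SetSystem n → Set
IntersectionClosed 𝓕 = ∀ I J → 𝓕 I → 𝓕 J → 𝓕 (I ∩ J)

-- |F| mod p ∈ L, where L ⊆ ℤ/pℤ is represented as a subset of Fin p
SizesModIn : ∀ {n} (p : ℕ) .{{_ : NonZero p}} → Subset p → SetSystem n → Set
SizesModIn p L 𝓕 = ∀ F → 𝓕 F → (∣ F ∣ mod p) ∈ L

Covers : ∀ {n} → ℕ → SetSystem n → Set
Covers s 𝓕 = ∀ S → ∣ S ∣ ≤ s → Σ _ λ F → 𝓕 F × (S ⊆ F)

-- Let P(x) = ∏_{ℓ ∈ L} (x − ℓ), a polynomial of degree s. By Newton interpolation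
-- P(|A|) = Σ_{S ⊆ A} c_{|S|} with c_k = Δᵏ P(0), and c_k = 0 for k > s, so only sets
-- of size at most s carry weight. Every such set lies in some member of 𝓕; choosing
-- finitely many members G₁, …, G_m that cover all of them, inclusion–exclusion writes
-- P(|X|) = Σ_{S ⊆ X} c_{|S|} as a signed sum of P(|G_{i₁} ∩ ⋯ ∩ G_{i_r}|). These
-- intersections lie in 𝓕, so their sizes are ≡ ℓ mod p for some ℓ ∈ L and p divides
-- each term; hence p ∣ P(|X|). But no factor |X| − ℓ is divisible by p, and p is prime.
module Submission where

open import Defs
open import Data.Bool using (true; false; if_then_else_)
open import Data.Empty using (⊥-elim)
open import Data.Fin as Fin using (Fin; toℕ)
import Data.Fin.Properties as Finₚ
open import Data.Fin.Subset using (Subset; inside; outside; ⊤; ∣_∣; _∈_; _∉_; _⊆_; _∩_)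
open import Data.Fin.Subset.Properties using (_⊆?_; ⊆⊤; p∩q⊆p; p∩q⊆q; x∈p∩q⁺; ∣⊤∣≡n)
open import Data.Integer as ℤ using (ℤ; +_; _+_; _-_; _*_; 0ℤ; 1ℤ)
import Data.Integer.Properties as ℤₚ
open import Data.Integer.Divisibility.Signed
open import Data.Integer.Tactic.RingSolver using (solve-∀)
open import Data.List using (List; []; _∷_; map; _++_)
open import Data.List.Membership.Propositional using () renaming (_∈_ to _∈ₗ_)
open import Data.List.Membership.Propositional.Properties using (∈-map⁺; ∈-++⁺ˡ; ∈-++⁺ʳ)
open import Data.List.Relation.Unary.All using (All; []; _∷_)
open import Data.List.Relation.Unary.Any using (Any; any?)
open import Data.Nat as ℕ using (ℕ; zero; suc; NonZero; _≤_; _<_; _≤?_; _%_; _/_)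
import Data.Nat.Divisibility as ℕᵈ
open import Data.Nat.DivMod using (_mod_; m≡m%n+[m/n]*n; m%n<n)
open import Data.Nat.Primality using (Prime; ¬prime[1]; euclidsLemma)
import Data.Nat.Properties as ℕₚ
open import Data.Vec using ([]; _∷_; here; there)
open import Data.Product using (Σ; _×_; _,_)
open import Data.Sum using (_⊎_; inj₁; inj₂)
open import Function using (_∘_)
open import Level using (0ℓ)
open import Relation.Binary.PropositionalEquality
open import Relation.Nullary using (¬_; yes; no; does)
open import Relation.Unary using (Pred; Decidable)
open import Algebra.Properties.CommutativeSemigroup ℤₚ.+-commutativeSemigroup
  using () renaming (interchange to +-interchange)

Δ : (ℕ → ℤ) → ℕ → ℤ
Δ f x = f (suc x) - f x

Δ^ : ℕ → (ℕ → ℤ) → ℕ → ℤ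
Δ^ zero    f = f
Δ^ (suc k) f = Δ^ k (Δ f)

-- binomialSum f m = Σ_k (m choose k) · f k
binomialSum : (ℕ → ℤ) → ℕ → ℤ
binomialSum f zero    = f 0
binomialSum f (suc m) = binomialSum f m + binomialSum (f ∘ suc) m

newton-interpolation : ∀ f m → binomialSum (λ k → Δ^ k f 0) m ≡ f m
newton-interpolation f zero    = refl
newton-interpolation f (suc m) = begin
    binomialSum (λ k → Δ^ k f 0) m + binomialSum (λ k → Δ^ k (Δ f) 0) m
  ≡⟨ cong₂ _+_ (newton-interpolation f m) (newton-interpolation (Δ f) m) ⟩
    f m + (f (suc m) - f m)
  ≡⟨ a+[b-a]≡b (f m) (f (suc m)) ⟩
    f (suc m)
  ∎
  where
  open ≡-Reasoning
  a+[b-a]≡b : ∀ a b → a + (b - a) ≡ b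
  a+[b-a]≡b = solve-∀

DegreeAtMost : ℕ → (ℕ → ℤ) → Set
DegreeAtMost d f = ∀ x → Δ^ (suc d) f x ≡ 0ℤ

Δ^-cong : ∀ k {f g} → (∀ x → f x ≡ g x) → ∀ x → Δ^ k f x ≡ Δ^ k g x
Δ^-cong zero    f≗g x = f≗g x
Δ^-cong (suc k) f≗g x = Δ^-cong k (λ y → cong₂ _-_ (f≗g (suc y)) (f≗g y)) x

Δ^-shift : ∀ k f x → Δ^ k (f ∘ suc) x ≡ Δ^ k f (suc x)
Δ^-shift zero    f x = refl
Δ^-shift (suc k) f x = Δ^-shift k (Δ f) x

Δ^-distrib-+ : ∀ k f g x → Δ^ k (λ y → f y + g y) x ≡ Δ^ k f x + Δ^ k g x
Δ^-distrib-+ zero    f g x = refl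
Δ^-distrib-+ (suc k) f g x = trans
  (Δ^-cong k (λ y → [a+b]-[c+d]≡[a-c]+[b-d] (f (suc y)) (g (suc y)) (f y) (g y)) x)
  (Δ^-distrib-+ k (Δ f) (Δ g) x)
  where
  [a+b]-[c+d]≡[a-c]+[b-d] : ∀ a b c d → (a + b) - (c + d) ≡ (a - c) + (b - d)
  [a+b]-[c+d]≡[a-c]+[b-d] = solve-∀

Δ^-zero : ∀ k {f} → (∀ x → f x ≡ 0ℤ) → ∀ x → Δ^ k f x ≡ 0ℤ
Δ^-zero zero    f≗0 x = f≗0 x
Δ^-zero (suc k) f≗0 x = Δ^-zero k (λ y → cong₂ _-_ (f≗0 (suc y)) (f≗0 y)) x

Δ^-+ : ∀ k j f x → Δ^ (k ℕ.+ j) f x ≡ Δ^ j (Δ^ k f) x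
Δ^-+ zero    j f x = refl
Δ^-+ (suc k) j f x = Δ^-+ k j (Δ f) x

Δ^-vanishes : ∀ {d f} → DegreeAtMost d f → ∀ {k} → d < k → ∀ x → Δ^ k f x ≡ 0ℤ
Δ^-vanishes {d} {f} f≤d {k} d<k x = subst (λ k → Δ^ k f x ≡ 0ℤ) (ℕₚ.m+[n∸m]≡n d<k)
  (trans (Δ^-+ (suc d) (k ℕ.∸ suc d) f x) (Δ^-zero (k ℕ.∸ suc d) f≤d x))

degree-mul-linear : ∀ d l f → DegreeAtMost d f → DegreeAtMost (suc d) (λ x → (+ x - l) * f x)
degree-mul-linear d l f f≤d x = begin
    Δ^ (suc d) (Δ (λ y → (+ y - l) * f y)) x
  ≡⟨ Δ^-cong (suc d) (λ y → Δ-mul-linear (+ y) l (f (suc y)) (f y)) x ⟩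
    Δ^ (suc d) (λ y → f (suc y) + (+ y - l) * Δ f y) x
  ≡⟨ Δ^-distrib-+ (suc d) (f ∘ suc) _ x ⟩
    Δ^ (suc d) (f ∘ suc) x + Δ^ (suc d) (λ y → (+ y - l) * Δ f y) x
  ≡⟨ cong₂ _+_ (trans (Δ^-shift (suc d) f x) (f≤d (suc x))) (degree-scaledΔ d {f} f≤d x) ⟩
    0ℤ
  ∎
  where
  open ≡-Reasoning
  Δ-mul-linear : ∀ y l a b → (1ℤ + y - l) * a - (y - l) * b ≡ a + (y - l) * (a - b)
  Δ-mul-linear = solve-∀
  degree-scaledΔ : ∀ d {f} → DegreeAtMost d f → DegreeAtMost d (λ y → (+ y - l) * Δ f y)
  degree-scaledΔ zero    f≤0 =
    Δ^-zero 1 (λ y → trans (cong (_*_ (+ y - l)) (f≤0 y)) (ℤₚ.*-zeroʳ (+ y - l)))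
  degree-scaledΔ (suc d) f≤d = degree-mul-linear d l _ f≤d

∏ : ∀ {k} → Subset k → (Fin k → ℤ) → ℤ
∏ []            f = 1ℤ
∏ (inside ∷ L)  f = f Fin.zero * ∏ L (f ∘ Fin.suc)
∏ (outside ∷ L) f = ∏ L (f ∘ Fin.suc)

∏-degree : ∀ {k} (L : Subset k) (g : Fin k → ℤ) → DegreeAtMost ∣ L ∣ (λ x → ∏ L (λ i → + x - g i))
∏-degree []            g = λ x → refl
∏-degree (inside ∷ L)  g = degree-mul-linear ∣ L ∣ (g Fin.zero) _ (∏-degree L (g ∘ Fin.suc))
∏-degree (outside ∷ L) g = ∏-degree L (g ∘ Fin.suc)

∣-∏ : ∀ {k} {L : Subset k} {f d i} → i ∈ L → d ∣ f i → d ∣ ∏ L f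
∣-∏ {L = inside ∷ L}  {f} here        d∣fi = ∣m⇒∣m*n (∏ L (f ∘ Fin.suc)) d∣fi
∣-∏ {L = inside ∷ L}  {f} (there i∈L) d∣fi = ∣n⇒∣m*n (f Fin.zero) (∣-∏ {f = f ∘ Fin.suc} i∈L d∣fi)
∣-∏ {L = outside ∷ L} {f} (there i∈L) d∣fi = ∣-∏ {f = f ∘ Fin.suc} i∈L d∣fi

module _ {p} (p-prime : Prime p) where

  prime∤1 : ¬ (+ p ∣ 1ℤ)
  prime∤1 p∣1 = ¬prime[1] (subst Prime (ℕᵈ.∣1⇒≡1 (∣⇒∣ᵤ p∣1)) p-prime)

  prime-∣-* : ∀ a b → + p ∣ a * b → (+ p ∣ a) ⊎ (+ p ∣ b)
  prime-∣-* a b p∣ab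
    with euclidsLemma ℤ.∣ a ∣ ℤ.∣ b ∣ p-prime (subst (p ℕᵈ.∣_) (ℤₚ.abs-* a b) (∣⇒∣ᵤ p∣ab))
  ... | inj₁ p∣a = inj₁ (∣ᵤ⇒∣ p∣a)
  ... | inj₂ p∣b = inj₂ (∣ᵤ⇒∣ p∣b)

  prime-∤-∏ : ∀ {k} (L : Subset k) f → (∀ i → i ∈ L → ¬ (+ p ∣ f i)) → ¬ (+ p ∣ ∏ L f)
  prime-∤-∏ []            f p∤f = prime∤1
  prime-∤-∏ (inside ∷ L)  f p∤f p∣∏ with prime-∣-* _ _ p∣∏
  ... | inj₁ p∣f0 = p∤f Fin.zero here p∣f0
  ... | inj₂ p∣∏L = prime-∤-∏ L (f ∘ Fin.suc) (λ i i∈L → p∤f (Fin.suc i) (there i∈L)) p∣∏L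
  prime-∤-∏ (outside ∷ L) f p∤f = prime-∤-∏ L (f ∘ Fin.suc) (λ i i∈L → p∤f (Fin.suc i) (there i∈L))

module _ {p} .{{_ : NonZero p}} where

  residue-unique : ∀ {a b} → a < p → b < p → + p ∣ + a - + b → a ≡ b
  residue-unique {a} {b} a<p b<p p∣a-b =
    ℤₚ.+-injective (ℤₚ.i-j≡0⇒i≡j (+ a) (+ b)
      (ℤₚ.∣i∣≡0⇒i≡0 (small-multiple-of-p (∣⇒∣ᵤ p∣a-b) ∣a-b∣<p)))
    where
    ∣a-b∣<p : ℤ.∣ + a - + b ∣ < p
    ∣a-b∣<p = ℕₚ.≤-<-trans
      (subst (ℕ._≤ a ℕ.⊔ b) (cong ℤ.∣_∣ (sym (ℤₚ.m-n≡m⊖n a b))) (ℤₚ.∣m⊝n∣≤m⊔n a b))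
      (ℕₚ.⊔-lub a<p b<p)
    small-multiple-of-p : ∀ {m} → p ℕᵈ.∣ m → m < p → m ≡ 0
    small-multiple-of-p {zero}  _   _   = refl
    small-multiple-of-p {suc m} p∣m m<p = ⊥-elim (ℕᵈ.>⇒∤ m<p p∣m)

  toℕ-mod : ∀ x → toℕ (x mod p) ≡ x % p
  toℕ-mod x = Finₚ.toℕ-fromℕ< (m%n<n x p)

  ∣-sub-mod : ∀ x → + p ∣ + x - + toℕ (x mod p)
  ∣-sub-mod x = divides (+ (x / p)) (begin
      + x - + toℕ (x mod p)
    ≡⟨ cong₂ (λ y r → + y - + r) (m≡m%n+[m/n]*n x p) (toℕ-mod x) ⟩
      + (x % p ℕ.+ x / p ℕ.* p) - + (x % p)
    ≡⟨ cong (_- + (x % p)) (trans (ℤₚ.pos-+ (x % p) _) (cong (_+_ (+ (x % p))) (ℤₚ.pos-* (x / p) p))) ⟩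
      + (x % p) + + (x / p) * + p - + (x % p)
    ≡⟨ [a+b]-a≡b (+ (x % p)) (+ (x / p) * + p) ⟩
      + (x / p) * + p
    ∎)
    where
    open ≡-Reasoning
    [a+b]-a≡b : ∀ a b → a + b - a ≡ b
    [a+b]-a≡b = solve-∀

  ∣-sub⇒mod≡ : ∀ x i → + p ∣ + x - + toℕ i → x mod p ≡ i
  ∣-sub⇒mod≡ x i p∣x-i = Finₚ.toℕ-injective
    (residue-unique (Finₚ.toℕ<n (x mod p)) (Finₚ.toℕ<n i)
      (subst (+ p ∣_) ([x-a]-[x-b]≡b-a (+ x) (+ toℕ i) (+ toℕ (x mod p)))
        (∣m∣n⇒∣m-n p∣x-i (∣-sub-mod x))))
    where
    [x-a]-[x-b]≡b-a : ∀ x a b → (x - a) - (x - b) ≡ b - a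
    [x-a]-[x-b]≡b-a = solve-∀

∑ : ∀ {n} → (Subset n → ℤ) → ℤ
∑ {zero}  φ = φ []
∑ {suc n} φ = ∑ (φ ∘ (outside ∷_)) + ∑ (φ ∘ (inside ∷_))

∑-cong : ∀ {n} {φ ψ : Subset n → ℤ} → (∀ S → φ S ≡ ψ S) → ∑ φ ≡ ∑ ψ
∑-cong {zero}  φ≗ψ = φ≗ψ []
∑-cong {suc n} φ≗ψ = cong₂ _+_ (∑-cong (φ≗ψ ∘ (outside ∷_))) (∑-cong (φ≗ψ ∘ (inside ∷_)))

∑-zero : ∀ {n} → ∑ {n} (λ _ → 0ℤ) ≡ 0ℤ
∑-zero {zero}  = refl
∑-zero {suc n} = cong₂ _+_ (∑-zero {n}) (∑-zero {n})

∑-distrib-+ : ∀ {n} (φ ψ : Subset n → ℤ) → ∑ (λ S → φ S + ψ S) ≡ ∑ φ + ∑ ψ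
∑-distrib-+ {zero}  φ ψ = refl
∑-distrib-+ {suc n} φ ψ =
  trans (cong₂ _+_ (∑-distrib-+ φ₀ ψ₀) (∑-distrib-+ φ₁ ψ₁)) (+-interchange (∑ φ₀) (∑ ψ₀) (∑ φ₁) (∑ ψ₁))
  where
  φ₀ φ₁ ψ₀ ψ₁ : Subset n → ℤ
  φ₀ = φ ∘ (outside ∷_)
  φ₁ = φ ∘ (inside ∷_)
  ψ₀ = ψ ∘ (outside ∷_)
  ψ₁ = ψ ∘ (inside ∷_)

_↾_ : ∀ {n} {P : Pred (Subset n) 0ℓ} → (Subset n → ℤ) → Decidable P → Subset n → ℤ
(φ ↾ P?) S = if does (P? S) then φ S else 0ℤ

∑-binomial : ∀ {n} (A : Subset n) f → ∑ ((f ∘ ∣_∣) ↾ (_⊆? A)) ≡ binomialSum f ∣ A ∣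
∑-binomial []                    f = refl
∑-binomial {suc n} (inside ∷ A)  f = cong₂ _+_ (∑-binomial A f) (∑-binomial A (f ∘ suc))
∑-binomial {suc n} (outside ∷ A) f =
  trans (cong₂ _+_ (∑-binomial A f) (∑-zero {n})) (ℤₚ.+-identityʳ (binomialSum f ∣ A ∣))

∑-↾⊤ : ∀ {n} (φ : Subset n → ℤ) → ∑ φ ≡ ∑ (φ ↾ (_⊆? ⊤))
∑-↾⊤ φ = ∑-cong ↾⊤
  where
  ↾⊤ : ∀ S → φ S ≡ (φ ↾ (_⊆? ⊤)) S
  ↾⊤ S with S ⊆? ⊤
  ... | yes _   = refl
  ... | no S⊈⊤ = ⊥-elim (S⊈⊤ ⊆⊤)

↾-⊆-∩ : ∀ {n} (φ : Subset n → ℤ) G F S → ((φ ↾ (_⊆? G)) ↾ (_⊆? F)) S ≡ (φ ↾ (_⊆? G ∩ F)) S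
↾-⊆-∩ φ G F S with S ⊆? G | S ⊆? F | S ⊆? G ∩ F
... | yes _   | yes _   | yes _      = refl
... | yes S⊆G | yes S⊆F | no S⊈G∩F  = ⊥-elim (S⊈G∩F (λ x∈S → x∈p∩q⁺ (S⊆G x∈S , S⊆F x∈S)))
... | yes _   | no S⊈F  | yes S⊆G∩F = ⊥-elim (S⊈F (p∩q⊆q G F ∘ S⊆G∩F))
... | yes _   | no _    | no _       = refl
... | no S⊈G  | _       | yes S⊆G∩F = ⊥-elim (S⊈G (p∩q⊆p G F ∘ S⊆G∩F))
... | no _    | yes _   | no _       = refl
... | no _    | no _    | no _       = refl

CoveredBy : ∀ {n} → List (Subset n) → Pred (Subset n) 0ℓ
CoveredBy Gs S = Any (S ⊆_) Gs

coveredBy? : ∀ {n} (Gs : List (Subset n)) → Decidable (CoveredBy Gs)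
coveredBy? Gs S = any? (S ⊆?_) Gs

↾-covered-∷ : ∀ {n} (φ : Subset n → ℤ) G Gs S →
  (φ ↾ coveredBy? (G ∷ Gs)) S + ((φ ↾ (_⊆? G)) ↾ coveredBy? Gs) S
    ≡ (φ ↾ (_⊆? G)) S + (φ ↾ coveredBy? Gs) S
↾-covered-∷ φ G Gs S with does (S ⊆? G) | does (coveredBy? Gs S)
... | true  | _     = refl
... | false | true  = ℤₚ.+-comm (φ S) 0ℤ
... | false | false = refl

∑-covered-∷ : ∀ {n} (φ : Subset n → ℤ) G Gs →
  ∑ (φ ↾ coveredBy? (G ∷ Gs)) + ∑ ((φ ↾ (_⊆? G)) ↾ coveredBy? Gs)
    ≡ ∑ (φ ↾ (_⊆? G)) + ∑ (φ ↾ coveredBy? Gs)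
∑-covered-∷ φ G Gs = begin
    ∑ (φ ↾ coveredBy? (G ∷ Gs)) + ∑ ((φ ↾ (_⊆? G)) ↾ coveredBy? Gs)
  ≡⟨ ∑-distrib-+ (φ ↾ coveredBy? (G ∷ Gs)) ((φ ↾ (_⊆? G)) ↾ coveredBy? Gs) ⟨
    ∑ (λ S → (φ ↾ coveredBy? (G ∷ Gs)) S + ((φ ↾ (_⊆? G)) ↾ coveredBy? Gs) S)
  ≡⟨ ∑-cong (↾-covered-∷ φ G Gs) ⟩
    ∑ (λ S → (φ ↾ (_⊆? G)) S + (φ ↾ coveredBy? Gs) S)
  ≡⟨ ∑-distrib-+ (φ ↾ (_⊆? G)) (φ ↾ coveredBy? Gs) ⟩
    ∑ (φ ↾ (_⊆? G)) + ∑ (φ ↾ coveredBy? Gs)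
  ∎
  where open ≡-Reasoning

-- Inclusion–exclusion on the first member G: the overlap term is the same problem for φ
-- restricted to G, and restricting that further to F ∈ 𝓕 restricts φ to G ∩ F ∈ 𝓕.
module _ {n} {𝓕 : SetSystem n} (closed : IntersectionClosed 𝓕) (d : ℤ) where

  ∣-∑-covered : ∀ {Gs} → All 𝓕 Gs →
    ∀ φ → (∀ F → 𝓕 F → d ∣ ∑ (φ ↾ (_⊆? F))) → d ∣ ∑ (φ ↾ coveredBy? Gs)
  ∣-∑-covered []                   φ d∣φ = subst (d ∣_) (sym (∑-zero {n})) (divides 0ℤ refl)
  ∣-∑-covered {G ∷ Gs} (𝓕G ∷ 𝓕Gs) φ d∣φ = ∣m+n∣n⇒∣m
    (subst (d ∣_) (sym (∑-covered-∷ φ G Gs)) (∣m∣n⇒∣m+n (d∣φ G 𝓕G) (∣-∑-covered 𝓕Gs φ d∣φ)))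
    (∣-∑-covered 𝓕Gs (φ ↾ (_⊆? G)) d∣φ↾G)
    where
    d∣φ↾G : ∀ F → 𝓕 F → d ∣ ∑ ((φ ↾ (_⊆? G)) ↾ (_⊆? F))
    d∣φ↾G F 𝓕F = subst (d ∣_) (∑-cong (sym ∘ ↾-⊆-∩ φ G F)) (d∣φ (G ∩ F) (closed G F 𝓕G 𝓕F))

subsets : ∀ n → List (Subset n)
subsets zero    = [] ∷ []
subsets (suc n) = map (outside ∷_) (subsets n) ++ map (inside ∷_) (subsets n)

∈-subsets : ∀ {n} (S : Subset n) → S ∈ₗ subsets n
∈-subsets []                  = Any.here refl
∈-subsets {suc n} (outside ∷ S) = ∈-++⁺ˡ (∈-map⁺ (outside ∷_) (∈-subsets S))
∈-subsets {suc n} (inside ∷ S)  = ∈-++⁺ʳ (map (outside ∷_) (subsets n)) (∈-map⁺ (inside ∷_) (∈-subsets S))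

finite-subcover : ∀ {n s} {𝓕 : SetSystem n} → Covers s 𝓕 → (Us : List (Subset n)) →
  Σ (List (Subset n)) λ Gs → All 𝓕 Gs × (∀ {U} → U ∈ₗ Us → ∣ U ∣ ≤ s → CoveredBy Gs U)
finite-subcover covers []       = [] , [] , λ ()
finite-subcover {s = s} covers (U ∷ Us) with finite-subcover covers Us | ∣ U ∣ ≤? s
... | Gs , 𝓕Gs , coverUs | no U-large = Gs , 𝓕Gs , λ
  { (Any.here refl) U-small → ⊥-elim (U-large U-small)
  ; (Any.there U∈Us) → coverUs U∈Us }
... | Gs , 𝓕Gs , coverUs | yes U-small with covers U U-small
... | G , 𝓕G , U⊆G = G ∷ Gs , 𝓕G ∷ 𝓕Gs , λ
  { (Any.here refl) _ → Any.here U⊆G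
  ; (Any.there U∈Us) V-small → Any.there (coverUs U∈Us V-small) }

polynomial-method : ∀ {n s} {𝓕 : SetSystem n} → IntersectionClosed 𝓕 → Covers s 𝓕 →
  ∀ {P} → DegreeAtMost s P → ∀ d → (∀ F → 𝓕 F → d ∣ P (∣ F ∣)) → d ∣ P n
polynomial-method {n} {s} closed covers {P} P≤s d d∣P with finite-subcover covers (subsets n)
... | Gs , 𝓕Gs , covering = subst (d ∣_) ∑w↾Gs≡Pn
  (∣-∑-covered closed d 𝓕Gs w (λ F 𝓕F → subst (d ∣_) (sym (∑w↾⊆≡P F)) (d∣P F 𝓕F)))
  where
  c : ℕ → ℤ
  c k = Δ^ k P 0
  w : Subset n → ℤ
  w S = c ∣ S ∣
  ∑w↾⊆≡P : ∀ A → ∑ (w ↾ (_⊆? A)) ≡ P ∣ A ∣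
  ∑w↾⊆≡P A = trans (∑-binomial A c) (newton-interpolation P ∣ A ∣)
  uncovered-weightless : ∀ S → (w ↾ coveredBy? Gs) S ≡ w S
  uncovered-weightless S with coveredBy? Gs S | ∣ S ∣ ≤? s
  ... | yes _       | _           = refl
  ... | no S-uncov  | yes S-small = ⊥-elim (S-uncov (covering (∈-subsets S) S-small))
  ... | no _        | no S-large  = sym (Δ^-vanishes P≤s (ℕₚ.≰⇒> S-large) 0)
  ∑w↾Gs≡Pn : ∑ (w ↾ coveredBy? Gs) ≡ P n
  ∑w↾Gs≡Pn = begin
      ∑ (w ↾ coveredBy? Gs)  ≡⟨ ∑-cong uncovered-weightless ⟩
      ∑ w                    ≡⟨ ∑-↾⊤ w ⟩
      ∑ (w ↾ (_⊆? ⊤))        ≡⟨ ∑w↾⊆≡P ⊤ ⟩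
      P ∣ ⊤ {n} ∣            ≡⟨ cong P (∣⊤∣≡n n) ⟩
      P n                    ∎
    where open ≡-Reasoning

proposition4p5 : (p : ℕ) → .{{_ : NonZero p}} → Prime p →
    (L : Subset p) → (s : ℕ) → ∣ L ∣ ≡ s →
    (n : ℕ) → (n mod p) ∉ L →
    ¬ (Σ (SetSystem n) λ 𝓕 → IntersectionClosed 𝓕 × SizesModIn p L 𝓕 × Covers s 𝓕)
proposition4p5 p p-prime L _ refl n n∉L (𝓕 , closed , sizes , covers) =
  prime-∤-∏ p-prime L (λ ℓ → + n - + toℕ ℓ) n-ℓ-not-divisible p∣P[n]
  where
  P : ℕ → ℤ
  P x = ∏ L (λ i → + x - + toℕ i)
  p∣P[n] : + p ∣ P n
  p∣P[n] = polynomial-method closed covers {P} (∏-degree L (λ i → + toℕ i)) (+ p)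
    (λ F 𝓕F → ∣-∏ {f = λ i → + ∣ F ∣ - + toℕ i} (sizes F 𝓕F) (∣-sub-mod ∣ F ∣))
  n-ℓ-not-divisible : ∀ ℓ → ℓ ∈ L → ¬ (+ p ∣ + n - + toℕ ℓ)
  n-ℓ-not-divisible ℓ ℓ∈L p∣n-ℓ = n∉L (subst (_∈ L) (sym (∣-sub⇒mod≡ n ℓ p∣n-ℓ)) ℓ∈L)
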